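{- Let $L$ be a $3$-Engel Lie algebra over a field of characteristic $5$. Then for all $b,c\in L$ the following identities hold in $A(L)$ (identifying each $x\in L$ with $\mathrm{ad}_x$): (1) $bc^2=c^2b$; (2) $b^2c^2=c^2b^2$; (3) $[b,c]^2=-b^2c^2$. Equivalently, for all $x,b,c\in L$: (1) $[x,b,c,c]=[x,c,c,b]$; (2) $[x,b,b,c,c]=[x,c,c,b,b]$; (3) $[x,[b,c],[b,c]]=-[x,b,b,c,c]$.
   Context: Brackets are left-normed: $[a_1,\ldots,a_n]=[\ldots[[a_1,a_2],a_3],\ldots,a_n]$. A Lie algebra $L$ is $3$-Engel if $[a,b,b,b]=0$ for all $a,b\in L$. For $a\in L$, $\mathrm{ad}_a:L\to L$ is the linear map $x\mapsto[x,a]$. $A(L)$ is the associative subalgebra of the algebra of linear endomorphisms of $L$ generated by all $\mathrm{ad}_a$, $a\in L$, where endomorphisms act on the right and are composed left to right, so that a product $b_1b_2\cdots b_n$ of elements of $L$ in $A(L)$ is the map $x\mapsto[x,b_1,b_2,\ldots,b_n]$; in particular $[b,c]$ in $A(L)$ is $\mathrm{ad}_{[b,c]}=bc-cb$. -}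

module Defs where

open import Level using (Level; _⊔_; suc)
open import Algebra.Bundles using (CommutativeRing)
open import Algebra.Module.Bundles using (Module)
open import Data.Product using (Σ; _×_)
open import Relation.Nullary using (¬_)

record IsField {c ℓ : Level} (R : CommutativeRing c ℓ) : Set (c ⊔ ℓ) where
  open CommutativeRing R
  field
    1≉0     : ¬ (1# ≈ 0#)
    inverse : ∀ x → ¬ (x ≈ 0#) → Σ Carrier (λ y → (x * y) ≈ 1#)

-- Characteristic 5 (for a field, since 5 is prime, 5·1 = 0 means the
-- characteristic is exactly 5).
HasChar5 : {c ℓ : Level} (R : CommutativeRing c ℓ) → Set ℓ
HasChar5 R = (1# + 1# + 1# + 1# + 1#) ≈ 0#
  where open CommutativeRing R

record LieAlgebra {c ℓ : Level} (R : CommutativeRing c ℓ) (m ℓm : Level)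
       : Set (c ⊔ ℓ ⊔ suc (m ⊔ ℓm)) where
  open CommutativeRing R using (Carrier)
  field
    module′ : Module R m ℓm
  open Module module′ public
  infixl 9 ⟦_,_⟧
  field
    ⟦_,_⟧       : Carrierᴹ → Carrierᴹ → Carrierᴹ
    ⟦⟧-cong     : ∀ {x x′ y y′} → x ≈ᴹ x′ → y ≈ᴹ y′ → ⟦ x , y ⟧ ≈ᴹ ⟦ x′ , y′ ⟧
    ⟦⟧-+ˡ       : ∀ x y z → ⟦ x +ᴹ y , z ⟧ ≈ᴹ (⟦ x , z ⟧ +ᴹ ⟦ y , z ⟧)
    ⟦⟧-+ʳ       : ∀ x y z → ⟦ x , y +ᴹ z ⟧ ≈ᴹ (⟦ x , y ⟧ +ᴹ ⟦ x , z ⟧)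
    ⟦⟧-*ˡ       : ∀ (a : Carrier) x y → ⟦ a *ₗ x , y ⟧ ≈ᴹ (a *ₗ ⟦ x , y ⟧)
    ⟦⟧-*ʳ       : ∀ (a : Carrier) x y → ⟦ x , a *ₗ y ⟧ ≈ᴹ (a *ₗ ⟦ x , y ⟧)
    ⟦⟧-alt      : ∀ x → ⟦ x , x ⟧ ≈ᴹ 0ᴹ
    jacobi      : ∀ x y z →
                  (⟦ ⟦ x , y ⟧ , z ⟧ +ᴹ ⟦ ⟦ y , z ⟧ , x ⟧ +ᴹ ⟦ ⟦ z , x ⟧ , y ⟧) ≈ᴹ 0ᴹ

Is3Engel : {c ℓ : Level} {R : CommutativeRing c ℓ} {m ℓm : Level}
           → LieAlgebra R m ℓm → Set (m ⊔ ℓm)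
Is3Engel L = ∀ a b → ⟦ ⟦ ⟦ a , b ⟧ , b ⟧ , b ⟧ ≈ᴹ 0ᴹ
  where open LieAlgebra L

-- Multilinearising the Engel identity [a,u,u,u] = 0 gives S(a; u, v, w) = 0, where S sums
-- [a,u′,v′,w′] over the six orderings (u′,v′,w′) of (u,v,w); this is the polarisation of the cubic
-- map u ↦ [a,u,u,u] and needs no division. With x inside a, or inside u, and
-- ad[s,t] = ad s ad t − ad t ad s, each instance becomes a linear relation among the words in
-- ad b and ad c applied to x. Each of the three identities is an 𝔽₅-linear combination of at
-- most three such instances, which is verified by collecting the coefficient of every word and
-- reducing it mod 5.
module Submission where

open import Defs
open import Level using (Level)
open import Algebra.Bundles using (CommutativeRing; CommutativeMonoid)
open import Data.List using (List; []; _∷_; _++_; foldr; map; concatMap)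
open import Data.List.Properties using (≡-dec)
open import Data.List.Relation.Unary.All using (All; []; _∷_; all?)
open import Data.Nat as ℕ using (ℕ; zero; suc; pred; NonZero)
open import Data.Nat.Divisibility using (_∣_; _∣?_; divides)
open import Data.Nat.Properties using (suc-pred)
open import Data.Product using (_×_; _,_; proj₁)
open import Relation.Binary.PropositionalEquality as ≡ using (_≡_)
open import Relation.Nullary using (yes; no)
open import Relation.Nullary.Decidable using (True; toWitness)
open import Relation.Unary using (Decidable)

module Polarisation {c ℓ} (M : CommutativeMonoid c ℓ) where

  open CommutativeMonoid M renaming (Carrier to A; _∙_ to _+_; ε to 0#; ∙-cong to +-cong)
  open import Algebra.Solver.CommutativeMonoid M using (solve; _⊜_; _⊕_; id)
  open import Relation.Binary.Reasoning.Setoid setoid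

  sum : List A → A
  sum = foldr _+_ 0#

  symmetrisation : (A → A → A → A) → A → A → A → A
  symmetrisation f u v w = sum (f u v w ∷ f u w v ∷ f v u w ∷ f v w u ∷ f w u v ∷ f w v u ∷ [])

  third-summand≈0 : ∀ {x y z} → x ≈ 0# → y ≈ 0# → (x + y) + z ≈ 0# → z ≈ 0#
  third-summand≈0 {x} {y} {z} x≈0 y≈0 xyz≈0 = begin
    z               ≈⟨ identityˡ z ⟨
    0# + z          ≈⟨ +-cong (identityˡ 0#) refl ⟨
    (0# + 0#) + z   ≈⟨ +-cong (+-cong x≈0 y≈0) refl ⟨
    (x + y) + z     ≈⟨ xyz≈0 ⟩
    0#              ∎

  module Trilinear (f : A → A → A → A)
    (f-+₁ : ∀ u u′ v w → f (u + u′) v w ≈ f u v w + f u′ v w)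
    (f-+₂ : ∀ u v v′ w → f u (v + v′) w ≈ f u v w + f u v′ w)
    (f-+₃ : ∀ u v w w′ → f u v (w + w′) ≈ f u v w + f u v w′)
    where

    f-+₁₂ : ∀ u u′ v v′ w → f (u + u′) (v + v′) w ≈ (f u v w + f u v′ w) + (f u′ v w + f u′ v′ w)
    f-+₁₂ u u′ v v′ w = trans (f-+₁ u u′ _ w) (+-cong (f-+₂ u v v′ w) (f-+₂ u′ v v′ w))

    f-+₁₃ : ∀ u u′ v w w′ → f (u + u′) v (w + w′) ≈ (f u v w + f u v w′) + (f u′ v w + f u′ v w′)
    f-+₁₃ u u′ v w w′ = trans (f-+₁ u u′ v _) (+-cong (f-+₃ u v w w′) (f-+₃ u′ v w w′))

    f-+₂₃ : ∀ u v v′ w w′ → f u (v + v′) (w + w′) ≈ (f u v w + f u v w′) + (f u v′ w + f u v′ w′)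
    f-+₂₃ u v v′ w w′ = trans (f-+₂ u v v′ _) (+-cong (f-+₃ u v w w′) (f-+₃ u v′ w w′))

    mixed : A → A → A
    mixed u v = sum (f u u v ∷ f u v u ∷ f v u u ∷ f u v v ∷ f v u v ∷ f v v u ∷ [])

    diagonal-+ : ∀ u v → f (u + v) (u + v) (u + v) ≈ (f u u u + f v v v) + mixed u v
    diagonal-+ u v = begin
      f (u + v) (u + v) (u + v)
        ≈⟨ trans (f-+₁ u v _ _) (+-cong (f-+₂₃ u u v u v) (f-+₂₃ v u v u v)) ⟩
      ((f u u u + f u u v) + (f u v u + f u v v)) + ((f v u u + f v u v) + (f v v u + f v v v))
        ≈⟨ solve 8 (λ uuu uuv uvu uvv vuu vuv vvu vvv →
                      ((uuu ⊕ uuv) ⊕ (uvu ⊕ uvv)) ⊕ ((vuu ⊕ vuv) ⊕ (vvu ⊕ vvv))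
                    ⊜ (uuu ⊕ vvv) ⊕ (uuv ⊕ (uvu ⊕ (vuu ⊕ (uvv ⊕ (vuv ⊕ (vvu ⊕ id)))))))
                 refl _ _ _ _ _ _ _ _ ⟩
      (f u u u + f v v v) + mixed u v ∎

    mixed-+ : ∀ u w v → mixed (u + w) v ≈ (mixed u v + mixed w v) + symmetrisation f u w v
    mixed-+ u w v = begin
      mixed (u + w) v
        ≈⟨ +-cong (f-+₁₂ u w u w v) (+-cong (f-+₁₃ u w v u w) (+-cong (f-+₂₃ v u w u w)
             (+-cong (f-+₁ u w v v) (+-cong (f-+₂ v u w v) (+-cong (f-+₃ v v u w) refl))))) ⟩
      ((f u u v + f u w v) + (f w u v + f w w v)) + (((f u v u + f u v w) + (f w v u + f w v w))
        + (((f v u u + f v u w) + (f v w u + f v w w)) + ((f u v v + f w v v)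
        + ((f v u v + f v w v) + ((f v v u + f v v w) + 0#)))))
        ≈⟨ solve 18 (λ uuv uwv wuv wwv uvu uvw wvu wvw vuu vuw vwu vww uvv wvv vuv vwv vvu vvw →
               ((uuv ⊕ uwv) ⊕ (wuv ⊕ wwv)) ⊕ (((uvu ⊕ uvw) ⊕ (wvu ⊕ wvw))
                 ⊕ (((vuu ⊕ vuw) ⊕ (vwu ⊕ vww)) ⊕ ((uvv ⊕ wvv)
                 ⊕ ((vuv ⊕ vwv) ⊕ ((vvu ⊕ vvw) ⊕ id)))))
             ⊜ ((uuv ⊕ (uvu ⊕ (vuu ⊕ (uvv ⊕ (vuv ⊕ (vvu ⊕ id))))))
                 ⊕ (wwv ⊕ (wvw ⊕ (vww ⊕ (wvv ⊕ (vwv ⊕ (vvw ⊕ id)))))))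
               ⊕ (uwv ⊕ (uvw ⊕ (wuv ⊕ (wvu ⊕ (vuw ⊕ (vwu ⊕ id)))))))
             refl _ _ _ _ _ _ _ _ _ _ _ _ _ _ _ _ _ _ ⟩
      (mixed u v + mixed w v) + symmetrisation f u w v ∎

    module _ (f-diagonal : ∀ u → f u u u ≈ 0#) where

      mixed≈0 : ∀ u v → mixed u v ≈ 0#
      mixed≈0 u v = third-summand≈0 (f-diagonal u) (f-diagonal v)
        (trans (sym (diagonal-+ u v)) (f-diagonal (u + v)))

      symmetrisation≈0 : ∀ u v w → symmetrisation f u v w ≈ 0#
      symmetrisation≈0 u v w = third-summand≈0 (mixed≈0 u w) (mixed≈0 v w)
        (trans (sym (mixed-+ u v w)) (mixed≈0 (u + v) w))

Word : Set
Word = List ℕ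

Poly : Set
Poly = List (ℕ × Word)

scale : ℕ → Poly → Poly
scale k = map (λ (n , w) → (k ℕ.* n , w))

infixl 7 _*ᴾ_
_*ᴾ_ : Poly → Poly → Poly
[] *ᴾ Q = []
((n , w) ∷ P) *ᴾ Q = map (λ (k , w′) → (k ℕ.* n , w ++ w′)) Q ++ P *ᴾ Q

insert : ℕ × Word → Poly → Poly
insert (n , w) [] = (n , w) ∷ []
insert (n , w) ((k , w′) ∷ P) with ≡-dec ℕ._≟_ w w′
... | yes _ = (n ℕ.+ k , w′) ∷ P
... | no _  = (k , w′) ∷ insert (n , w) P

collect : Poly → Poly
collect = foldr insert []

VanishesMod : ℕ → Poly → Set
VanishesMod p P = All (λ t → p ∣ proj₁ t) (collect P)

vanishesMod? : ∀ p → Decidable (VanishesMod p)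
vanishesMod? p P = all? (λ t → p ∣? proj₁ t) (collect P)

infixl 9 _⊛_
data Term : Set where
  var : ℕ → Term
  _⊛_ : Term → Term → Term

infixl 8 _◁_
infixr 8 _▷_
-- Lie terms in which the argument x, written •, occurs exactly once.
data LinearTerm : Set where
  • : LinearTerm
  _◁_ : LinearTerm → Term → LinearTerm
  _▷_ : Term → LinearTerm → LinearTerm

-- Both constructors stand for S(a; u, v, w), with x occurring in a, resp. in u; since S is
-- symmetric in u, v, w, these are all the instances that are linear in x.
data EngelInstance : Set where
  outer : LinearTerm → Term → Term → Term → EngelInstance
  inner : Term → LinearTerm → Term → Term → EngelInstance

instanceTerms : EngelInstance → List LinearTerm
instanceTerms (outer a u v w) =
  a ◁ u ◁ v ◁ w ∷ a ◁ u ◁ w ◁ v ∷ a ◁ v ◁ u ◁ w ∷ a ◁ v ◁ w ◁ u ∷ a ◁ w ◁ u ◁ v ∷ a ◁ w ◁ v ◁ u ∷ []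
instanceTerms (inner a u v w) =
  (a ▷ u) ◁ v ◁ w ∷ (a ▷ u) ◁ w ◁ v ∷ ((a ⊛ v) ▷ u) ◁ w ∷ (a ⊛ v ⊛ w) ▷ u
    ∷ ((a ⊛ w) ▷ u) ◁ v ∷ (a ⊛ w ⊛ v) ▷ u ∷ []

Certificate : Set
Certificate = List (ℕ × EngelInstance)

module _ {r ℓ m ℓm : Level} {F : CommutativeRing r ℓ} (L : LieAlgebra F m ℓm) where

  open LieAlgebra L
  open import Relation.Binary.Reasoning.Setoid ≈ᴹ-setoid
  open import Algebra.Properties.AbelianGroup +ᴹ-abelianGroup
    using (identityˡ-unique; inverseˡ-unique; inverseʳ-unique; ⁻¹-involutive; x∙y⁻¹≈ε⇒x≈y)
  open import Algebra.Properties.CommutativeMonoid.Mult +ᴹ-commutativeMonoid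
    using (×-congʳ; ×-congˡ; ×-homo-+; ×-assocˡ; ×-distrib-+) renaming (_×_ to _×ᴹ_)
  open import Algebra.Properties.CommutativeSemigroup
    (CommutativeMonoid.commutativeSemigroup +ᴹ-commutativeMonoid) using (x∙yz≈y∙xz; interchange)
  open Polarisation +ᴹ-commutativeMonoid using (sum; symmetrisation; module Trilinear)
  private module R = CommutativeRing F

  ×ᴹ-char5 : HasChar5 F → ∀ u → 5 ×ᴹ u ≈ᴹ 0ᴹ
  ×ᴹ-char5 char5 u = begin
    5 ×ᴹ u        ≈⟨ ones-*ₗ 4 ⟨
    ones 4 *ₗ u   ≈⟨ *ₗ-cong char5 ≈ᴹ-refl ⟩
    R.0# *ₗ u     ≈⟨ *ₗ-zeroˡ u ⟩
    0ᴹ            ∎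
    where
    ones : ℕ → R.Carrier
    ones zero    = R.1#
    ones (suc n) = ones n R.+ R.1#

    ones-*ₗ : ∀ n → ones n *ₗ u ≈ᴹ suc n ×ᴹ u
    ones-*ₗ zero    = ≈ᴹ-trans (*ₗ-identityˡ u) (≈ᴹ-sym (+ᴹ-identityʳ u))
    ones-*ₗ (suc n) = begin
      (ones n R.+ R.1#) *ₗ u     ≈⟨ *ₗ-distribʳ u (ones n) R.1# ⟩
      ones n *ₗ u +ᴹ R.1# *ₗ u   ≈⟨ +ᴹ-cong (ones-*ₗ n) (*ₗ-identityˡ u) ⟩
      suc n ×ᴹ u +ᴹ u            ≈⟨ +ᴹ-comm _ u ⟩
      suc (suc n) ×ᴹ u           ∎

  module Additive (g : Carrierᴹ → Carrierᴹ) (g-cong : ∀ {u v} → u ≈ᴹ v → g u ≈ᴹ g v)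
                  (g-+ : ∀ u v → g (u +ᴹ v) ≈ᴹ g u +ᴹ g v) where

    0ᴹ-homo : g 0ᴹ ≈ᴹ 0ᴹ
    0ᴹ-homo = identityˡ-unique (g 0ᴹ) (g 0ᴹ) (begin
      g 0ᴹ +ᴹ g 0ᴹ   ≈⟨ g-+ 0ᴹ 0ᴹ ⟨
      g (0ᴹ +ᴹ 0ᴹ)   ≈⟨ g-cong (+ᴹ-identityˡ 0ᴹ) ⟩
      g 0ᴹ           ∎)

    -ᴹ-homo : ∀ u → g (-ᴹ u) ≈ᴹ -ᴹ g u
    -ᴹ-homo u = inverseʳ-unique (g u) (g (-ᴹ u)) (begin
      g u +ᴹ g (-ᴹ u)  ≈⟨ g-+ u (-ᴹ u) ⟨
      g (u +ᴹ -ᴹ u)    ≈⟨ g-cong (-ᴹ‿inverseʳ u) ⟩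
      g 0ᴹ             ≈⟨ 0ᴹ-homo ⟩
      0ᴹ               ∎)

    ×ᴹ-homo : ∀ n u → g (n ×ᴹ u) ≈ᴹ n ×ᴹ g u
    ×ᴹ-homo zero    u = 0ᴹ-homo
    ×ᴹ-homo (suc n) u = ≈ᴹ-trans (g-+ u (n ×ᴹ u)) (+ᴹ-congˡ (×ᴹ-homo n u))

  ×ᴹ-zeroʳ : ∀ n → n ×ᴹ 0ᴹ ≈ᴹ 0ᴹ
  ×ᴹ-zeroʳ n = Additive.0ᴹ-homo (n ×ᴹ_) (×-congʳ n) (λ u v → ×-distrib-+ u v n)

  ⟦⟧-congˡ : ∀ {u u′} v → u ≈ᴹ u′ → ⟦ u , v ⟧ ≈ᴹ ⟦ u′ , v ⟧
  ⟦⟧-congˡ v u≈u′ = ⟦⟧-cong u≈u′ ≈ᴹ-refl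

  ⟦⟧-negˡ : ∀ u v → ⟦ -ᴹ u , v ⟧ ≈ᴹ -ᴹ ⟦ u , v ⟧
  ⟦⟧-negˡ u v = Additive.-ᴹ-homo (λ u → ⟦ u , v ⟧) (⟦⟧-congˡ v) (λ u u′ → ⟦⟧-+ˡ u u′ v) u

  ⟦⟧-anticomm : ∀ u v → ⟦ u , v ⟧ ≈ᴹ -ᴹ ⟦ v , u ⟧
  ⟦⟧-anticomm u v = inverseˡ-unique ⟦ u , v ⟧ ⟦ v , u ⟧ (begin
    ⟦ u , v ⟧ +ᴹ ⟦ v , u ⟧
      ≈⟨ +ᴹ-cong (+ᴹ-identityˡ _) (+ᴹ-identityʳ _) ⟨
    (0ᴹ +ᴹ ⟦ u , v ⟧) +ᴹ (⟦ v , u ⟧ +ᴹ 0ᴹ)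
      ≈⟨ +ᴹ-cong (+ᴹ-congʳ (⟦⟧-alt u)) (+ᴹ-congˡ (⟦⟧-alt v)) ⟨
    (⟦ u , u ⟧ +ᴹ ⟦ u , v ⟧) +ᴹ (⟦ v , u ⟧ +ᴹ ⟦ v , v ⟧)
      ≈⟨ +ᴹ-cong (⟦⟧-+ʳ u u v) (⟦⟧-+ʳ v u v) ⟨
    ⟦ u , u +ᴹ v ⟧ +ᴹ ⟦ v , u +ᴹ v ⟧
      ≈⟨ ⟦⟧-+ˡ u v (u +ᴹ v) ⟨
    ⟦ u +ᴹ v , u +ᴹ v ⟧
      ≈⟨ ⟦⟧-alt (u +ᴹ v) ⟩
    0ᴹ ∎)

  ad-⟦⟧ : ∀ v s t → ⟦ v , ⟦ s , t ⟧ ⟧ ≈ᴹ ⟦ ⟦ v , s ⟧ , t ⟧ +ᴹ -ᴹ ⟦ ⟦ v , t ⟧ , s ⟧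
  ad-⟦⟧ v s t = begin
    ⟦ v , ⟦ s , t ⟧ ⟧           ≈⟨ ⟦⟧-anticomm v ⟦ s , t ⟧ ⟩
    -ᴹ ⟦ ⟦ s , t ⟧ , v ⟧        ≈⟨ -ᴹ‿cong (inverseˡ-unique _ _ jacobi′) ⟩
    -ᴹ (-ᴹ (vst +ᴹ tvs))        ≈⟨ ⁻¹-involutive (vst +ᴹ tvs) ⟩
    vst +ᴹ tvs                  ≈⟨ +ᴹ-congˡ (≈ᴹ-trans (⟦⟧-congˡ s (⟦⟧-anticomm t v)) (⟦⟧-negˡ _ s)) ⟩
    vst +ᴹ -ᴹ ⟦ ⟦ v , t ⟧ , s ⟧ ∎
    where
    vst tvs : Carrierᴹ
    vst = ⟦ ⟦ v , s ⟧ , t ⟧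
    tvs = ⟦ ⟦ t , v ⟧ , s ⟧

    jacobi′ : ⟦ ⟦ s , t ⟧ , v ⟧ +ᴹ (vst +ᴹ tvs) ≈ᴹ 0ᴹ
    jacobi′ = ≈ᴹ-trans (≈ᴹ-trans (≈ᴹ-sym (+ᴹ-assoc _ vst tvs)) (+ᴹ-congʳ (+ᴹ-comm _ vst)))
                       (jacobi v s t)

  engel-symmetrisation : Is3Engel L →
    ∀ a u v w → symmetrisation (λ u v w → ⟦ ⟦ ⟦ a , u ⟧ , v ⟧ , w ⟧) u v w ≈ᴹ 0ᴹ
  engel-symmetrisation engel a = Trilinear.symmetrisation≈0 f +₁ +₂ +₃ (engel a)
    where
    f : Carrierᴹ → Carrierᴹ → Carrierᴹ → Carrierᴹ
    f u v w = ⟦ ⟦ ⟦ a , u ⟧ , v ⟧ , w ⟧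

    +₁ : ∀ u u′ v w → f (u +ᴹ u′) v w ≈ᴹ f u v w +ᴹ f u′ v w
    +₁ u u′ v w =
      ≈ᴹ-trans (⟦⟧-congˡ w (≈ᴹ-trans (⟦⟧-congˡ v (⟦⟧-+ʳ a u u′)) (⟦⟧-+ˡ _ _ v))) (⟦⟧-+ˡ _ _ w)

    +₂ : ∀ u v v′ w → f u (v +ᴹ v′) w ≈ᴹ f u v w +ᴹ f u v′ w
    +₂ u v v′ w = ≈ᴹ-trans (⟦⟧-congˡ w (⟦⟧-+ʳ _ v v′)) (⟦⟧-+ˡ _ _ w)

    +₃ : ∀ u v w w′ → f u v (w +ᴹ w′) ≈ᴹ f u v w +ᴹ f u v w′
    +₃ u v w w′ = ⟦⟧-+ʳ _ w w′

  module AdjointAlgebra (p : ℕ) .{{_ : NonZero p}} (char-p : ∀ u → p ×ᴹ u ≈ᴹ 0ᴹ)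
                        (gen : ℕ → Carrierᴹ) where

    infixl 7 _·ʷ_ _·ᴾ_

    _·ʷ_ : Carrierᴹ → Word → Carrierᴹ
    v ·ʷ []      = v
    v ·ʷ (i ∷ w) = ⟦ v , gen i ⟧ ·ʷ w

    ·ʷ-cong : ∀ w {u v} → u ≈ᴹ v → u ·ʷ w ≈ᴹ v ·ʷ w
    ·ʷ-cong []      u≈v = u≈v
    ·ʷ-cong (i ∷ w) u≈v = ·ʷ-cong w (⟦⟧-congˡ (gen i) u≈v)

    ·ʷ-+ : ∀ w u v → (u +ᴹ v) ·ʷ w ≈ᴹ u ·ʷ w +ᴹ v ·ʷ w
    ·ʷ-+ []      u v = ≈ᴹ-refl
    ·ʷ-+ (i ∷ w) u v = ≈ᴹ-trans (·ʷ-cong w (⟦⟧-+ˡ u v (gen i))) (·ʷ-+ w _ _)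

    ·ʷ-++ : ∀ w w′ v → v ·ʷ (w ++ w′) ≡ v ·ʷ w ·ʷ w′
    ·ʷ-++ []      w′ v = ≡.refl
    ·ʷ-++ (i ∷ w) w′ v = ·ʷ-++ w w′ ⟦ v , gen i ⟧

    _·ᴾ_ : Carrierᴹ → Poly → Carrierᴹ
    v ·ᴾ []            = 0ᴹ
    v ·ᴾ ((n , w) ∷ P) = n ×ᴹ (v ·ʷ w) +ᴹ v ·ᴾ P

    ·ᴾ-cong : ∀ P {u v} → u ≈ᴹ v → u ·ᴾ P ≈ᴹ v ·ᴾ P
    ·ᴾ-cong []            u≈v = ≈ᴹ-refl
    ·ᴾ-cong ((n , w) ∷ P) u≈v = +ᴹ-cong (×-congʳ n (·ʷ-cong w u≈v)) (·ᴾ-cong P u≈v)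

    ·ᴾ-+ : ∀ P u v → (u +ᴹ v) ·ᴾ P ≈ᴹ u ·ᴾ P +ᴹ v ·ᴾ P
    ·ᴾ-+ []            u v = ≈ᴹ-sym (+ᴹ-identityˡ 0ᴹ)
    ·ᴾ-+ ((n , w) ∷ P) u v = begin
      n ×ᴹ ((u +ᴹ v) ·ʷ w) +ᴹ (u +ᴹ v) ·ᴾ P
        ≈⟨ +ᴹ-cong (≈ᴹ-trans (×-congʳ n (·ʷ-+ w u v)) (×-distrib-+ _ _ n)) (·ᴾ-+ P u v) ⟩
      (n ×ᴹ (u ·ʷ w) +ᴹ n ×ᴹ (v ·ʷ w)) +ᴹ (u ·ᴾ P +ᴹ v ·ᴾ P)
        ≈⟨ interchange _ _ _ _ ⟩
      (n ×ᴹ (u ·ʷ w) +ᴹ u ·ᴾ P) +ᴹ (n ×ᴹ (v ·ʷ w) +ᴹ v ·ᴾ P) ∎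

    ·ᴾ-++ : ∀ P Q v → v ·ᴾ (P ++ Q) ≈ᴹ v ·ᴾ P +ᴹ v ·ᴾ Q
    ·ᴾ-++ []            Q v = ≈ᴹ-sym (+ᴹ-identityˡ _)
    ·ᴾ-++ ((n , w) ∷ P) Q v = ≈ᴹ-trans (+ᴹ-congˡ (·ᴾ-++ P Q v)) (≈ᴹ-sym (+ᴹ-assoc _ _ _))

    ·ᴾ-scale : ∀ k P v → v ·ᴾ scale k P ≈ᴹ k ×ᴹ (v ·ᴾ P)
    ·ᴾ-scale k []            v = ≈ᴹ-sym (×ᴹ-zeroʳ k)
    ·ᴾ-scale k ((n , w) ∷ P) v = begin
      (k ℕ.* n) ×ᴹ (v ·ʷ w) +ᴹ v ·ᴾ scale k P     ≈⟨ +ᴹ-cong (≈ᴹ-sym (×-assocˡ _ k n)) (·ᴾ-scale k P v) ⟩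
      k ×ᴹ (n ×ᴹ (v ·ʷ w)) +ᴹ k ×ᴹ (v ·ᴾ P)       ≈⟨ ×-distrib-+ _ _ k ⟨
      k ×ᴹ (n ×ᴹ (v ·ʷ w) +ᴹ v ·ᴾ P)              ∎

    pred-p-×ᴹ : ∀ u → pred p ×ᴹ u ≈ᴹ -ᴹ u
    pred-p-×ᴹ u = inverseʳ-unique u (pred p ×ᴹ u) (≈ᴹ-trans (×-congˡ (suc-pred p)) (char-p u))

    -- Coefficients are natural numbers read modulo p, so −P is (p − 1)·P.
    negate : Poly → Poly
    negate = scale (pred p)

    ·ᴾ-negate : ∀ P v → v ·ᴾ negate P ≈ᴹ -ᴹ (v ·ᴾ P)
    ·ᴾ-negate P v = ≈ᴹ-trans (·ᴾ-scale (pred p) P v) (pred-p-×ᴹ _)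

    ·ᴾ-prefix : ∀ n w Q v → v ·ᴾ map (λ (k , w′) → (k ℕ.* n , w ++ w′)) Q ≈ᴹ n ×ᴹ (v ·ʷ w) ·ᴾ Q
    ·ᴾ-prefix n w []             v = ≈ᴹ-refl
    ·ᴾ-prefix n w ((k , w′) ∷ Q) v = +ᴹ-cong (begin
      (k ℕ.* n) ×ᴹ (v ·ʷ (w ++ w′))   ≡⟨ ≡.cong ((k ℕ.* n) ×ᴹ_) (·ʷ-++ w w′ v) ⟩
      (k ℕ.* n) ×ᴹ (v ·ʷ w ·ʷ w′)     ≈⟨ ×-assocˡ _ k n ⟨
      k ×ᴹ (n ×ᴹ (v ·ʷ w ·ʷ w′))      ≈⟨ ×-congʳ k (Additive.×ᴹ-homo (_·ʷ w′) (·ʷ-cong w′) (·ʷ-+ w′) n _) ⟨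
      k ×ᴹ (n ×ᴹ (v ·ʷ w) ·ʷ w′)      ∎) (·ᴾ-prefix n w Q v)

    ·ᴾ-*ᴾ : ∀ P Q v → v ·ᴾ (P *ᴾ Q) ≈ᴹ v ·ᴾ P ·ᴾ Q
    ·ᴾ-*ᴾ []            Q v = ≈ᴹ-sym (Additive.0ᴹ-homo (_·ᴾ Q) (·ᴾ-cong Q) (·ᴾ-+ Q))
    ·ᴾ-*ᴾ ((n , w) ∷ P) Q v = begin
      v ·ᴾ (map _ Q ++ P *ᴾ Q)                     ≈⟨ ·ᴾ-++ (map _ Q) (P *ᴾ Q) v ⟩
      v ·ᴾ map _ Q +ᴹ v ·ᴾ (P *ᴾ Q)                ≈⟨ +ᴹ-cong (·ᴾ-prefix n w Q v) (·ᴾ-*ᴾ P Q v) ⟩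
      n ×ᴹ (v ·ʷ w) ·ᴾ Q +ᴹ v ·ᴾ P ·ᴾ Q            ≈⟨ ·ᴾ-+ Q _ _ ⟨
      (n ×ᴹ (v ·ʷ w) +ᴹ v ·ᴾ P) ·ᴾ Q               ∎

    ⟦_⟧ᵗ : Term → Carrierᴹ
    ⟦ var i ⟧ᵗ = gen i
    ⟦ s ⊛ t ⟧ᵗ = ⟦ ⟦ s ⟧ᵗ , ⟦ t ⟧ᵗ ⟧

    ad : Term → Poly
    ad (var i) = (1 , i ∷ []) ∷ []
    ad (s ⊛ t) = ad s *ᴾ ad t ++ negate (ad t *ᴾ ad s)

    ad-correct : ∀ t v → ⟦ v , ⟦ t ⟧ᵗ ⟧ ≈ᴹ v ·ᴾ ad t
    ad-correct (var i) v = ≈ᴹ-sym (≈ᴹ-trans (+ᴹ-identityʳ _) (+ᴹ-identityʳ _))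
    ad-correct (s ⊛ t) v = begin
      ⟦ v , ⟦ ⟦ s ⟧ᵗ , ⟦ t ⟧ᵗ ⟧ ⟧
        ≈⟨ ad-⟦⟧ v ⟦ s ⟧ᵗ ⟦ t ⟧ᵗ ⟩
      ⟦ ⟦ v , ⟦ s ⟧ᵗ ⟧ , ⟦ t ⟧ᵗ ⟧ +ᴹ -ᴹ ⟦ ⟦ v , ⟦ t ⟧ᵗ ⟧ , ⟦ s ⟧ᵗ ⟧
        ≈⟨ +ᴹ-cong (ad-*ᴾ s t) (-ᴹ‿cong (ad-*ᴾ t s)) ⟩
      v ·ᴾ (ad s *ᴾ ad t) +ᴹ -ᴹ (v ·ᴾ (ad t *ᴾ ad s))
        ≈⟨ +ᴹ-congˡ (·ᴾ-negate (ad t *ᴾ ad s) v) ⟨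
      v ·ᴾ (ad s *ᴾ ad t) +ᴹ v ·ᴾ negate (ad t *ᴾ ad s)
        ≈⟨ ·ᴾ-++ (ad s *ᴾ ad t) _ v ⟨
      v ·ᴾ ad (s ⊛ t) ∎
      where
      ad-*ᴾ : ∀ s t → ⟦ ⟦ v , ⟦ s ⟧ᵗ ⟧ , ⟦ t ⟧ᵗ ⟧ ≈ᴹ v ·ᴾ (ad s *ᴾ ad t)
      ad-*ᴾ s t = ≈ᴹ-trans (ad-correct t _)
        (≈ᴹ-trans (·ᴾ-cong (ad t) (ad-correct s v)) (≈ᴹ-sym (·ᴾ-*ᴾ (ad s) (ad t) v)))

    ⟦_⟧ˡ : LinearTerm → Carrierᴹ → Carrierᴹ
    ⟦ •     ⟧ˡ x = x
    ⟦ e ◁ t ⟧ˡ x = ⟦ ⟦ e ⟧ˡ x , ⟦ t ⟧ᵗ ⟧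
    ⟦ t ▷ e ⟧ˡ x = ⟦ ⟦ t ⟧ᵗ , ⟦ e ⟧ˡ x ⟧

    linearPoly : LinearTerm → Poly
    linearPoly •       = (1 , []) ∷ []
    linearPoly (e ◁ t) = linearPoly e *ᴾ ad t
    linearPoly (t ▷ e) = negate (linearPoly e *ᴾ ad t)

    ◁-correct : ∀ e t x → ⟦ e ⟧ˡ x ≈ᴹ x ·ᴾ linearPoly e → ⟦ e ◁ t ⟧ˡ x ≈ᴹ x ·ᴾ linearPoly (e ◁ t)
    ◁-correct e t x e-correct = ≈ᴹ-trans (ad-correct t _)
      (≈ᴹ-trans (·ᴾ-cong (ad t) e-correct) (≈ᴹ-sym (·ᴾ-*ᴾ (linearPoly e) (ad t) x)))

    linearPoly-correct : ∀ e x → ⟦ e ⟧ˡ x ≈ᴹ x ·ᴾ linearPoly e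
    linearPoly-correct •       x = ≈ᴹ-sym (≈ᴹ-trans (+ᴹ-identityʳ _) (+ᴹ-identityʳ x))
    linearPoly-correct (e ◁ t) x = ◁-correct e t x (linearPoly-correct e x)
    linearPoly-correct (t ▷ e) x = begin
      ⟦ ⟦ t ⟧ᵗ , ⟦ e ⟧ˡ x ⟧                   ≈⟨ ⟦⟧-anticomm _ _ ⟩
      -ᴹ ⟦ e ◁ t ⟧ˡ x                         ≈⟨ -ᴹ‿cong (◁-correct e t x (linearPoly-correct e x)) ⟩
      -ᴹ (x ·ᴾ (linearPoly e *ᴾ ad t))        ≈⟨ ·ᴾ-negate (linearPoly e *ᴾ ad t) x ⟨
      x ·ᴾ linearPoly (t ▷ e)                 ∎

    ·ᴾ-concatMap : ∀ es x → x ·ᴾ concatMap linearPoly es ≈ᴹ sum (map (λ e → ⟦ e ⟧ˡ x) es)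
    ·ᴾ-concatMap []       x = ≈ᴹ-refl
    ·ᴾ-concatMap (e ∷ es) x = ≈ᴹ-trans (·ᴾ-++ (linearPoly e) _ x)
      (+ᴹ-cong (≈ᴹ-sym (linearPoly-correct e x)) (·ᴾ-concatMap es x))

    instancePoly : EngelInstance → Poly
    instancePoly i = concatMap linearPoly (instanceTerms i)

    certificatePoly : Certificate → Poly
    certificatePoly = concatMap (λ (k , i) → scale k (instancePoly i))

    module _ (engel : Is3Engel L) where

      -- The six terms of an instance evaluate definitionally to the six summands of S.
      instancePoly-vanishes : ∀ i x → x ·ᴾ instancePoly i ≈ᴹ 0ᴹ
      instancePoly-vanishes i@(outer a u v w) x = ≈ᴹ-trans (·ᴾ-concatMap (instanceTerms i) x)
        (engel-symmetrisation engel (⟦ a ⟧ˡ x) ⟦ u ⟧ᵗ ⟦ v ⟧ᵗ ⟦ w ⟧ᵗ)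
      instancePoly-vanishes i@(inner a u v w) x = ≈ᴹ-trans (·ᴾ-concatMap (instanceTerms i) x)
        (engel-symmetrisation engel ⟦ a ⟧ᵗ (⟦ u ⟧ˡ x) ⟦ v ⟧ᵗ ⟦ w ⟧ᵗ)

      certificatePoly-vanishes : ∀ cs x → x ·ᴾ certificatePoly cs ≈ᴹ 0ᴹ
      certificatePoly-vanishes []             x = ≈ᴹ-refl
      certificatePoly-vanishes ((k , i) ∷ cs) x = begin
        x ·ᴾ (scale k (instancePoly i) ++ certificatePoly cs)
          ≈⟨ ·ᴾ-++ (scale k (instancePoly i)) _ x ⟩
        x ·ᴾ scale k (instancePoly i) +ᴹ x ·ᴾ certificatePoly cs
          ≈⟨ +ᴹ-cong (·ᴾ-scale k (instancePoly i) x) (certificatePoly-vanishes cs x) ⟩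
        k ×ᴹ (x ·ᴾ instancePoly i) +ᴹ 0ᴹ
          ≈⟨ +ᴹ-cong (≈ᴹ-trans (×-congʳ k (instancePoly-vanishes i x)) (×ᴹ-zeroʳ k)) ≈ᴹ-refl ⟩
        0ᴹ +ᴹ 0ᴹ
          ≈⟨ +ᴹ-identityˡ 0ᴹ ⟩
        0ᴹ ∎

    ·ᴾ-insert : ∀ t P v → v ·ᴾ insert t P ≈ᴹ v ·ᴾ (t ∷ P)
    ·ᴾ-insert t       []               v = ≈ᴹ-refl
    ·ᴾ-insert (n , w) ((k , w′) ∷ P) v with ≡-dec ℕ._≟_ w w′
    ... | yes ≡.refl = ≈ᴹ-trans (+ᴹ-congʳ (×-homo-+ _ n k)) (+ᴹ-assoc _ _ _)
    ... | no _       = ≈ᴹ-trans (+ᴹ-congˡ (·ᴾ-insert (n , w) P v)) (x∙yz≈y∙xz _ _ _)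

    ·ᴾ-collect : ∀ P v → v ·ᴾ collect P ≈ᴹ v ·ᴾ P
    ·ᴾ-collect []            v = ≈ᴹ-refl
    ·ᴾ-collect ((n , w) ∷ P) v =
      ≈ᴹ-trans (·ᴾ-insert (n , w) (collect P) v) (+ᴹ-congˡ (·ᴾ-collect P v))

    ×ᴹ-divisible : ∀ {n} → p ∣ n → ∀ u → n ×ᴹ u ≈ᴹ 0ᴹ
    ×ᴹ-divisible (divides q ≡.refl) u =
      ≈ᴹ-trans (≈ᴹ-sym (×-assocˡ u q p)) (≈ᴹ-trans (×-congʳ q (char-p u)) (×ᴹ-zeroʳ q))

    ·ᴾ-divisible : ∀ {P} → All (λ t → p ∣ proj₁ t) P → ∀ v → v ·ᴾ P ≈ᴹ 0ᴹ
    ·ᴾ-divisible []         v = ≈ᴹ-refl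
    ·ᴾ-divisible (p∣n ∷ ps) v =
      ≈ᴹ-trans (+ᴹ-cong (×ᴹ-divisible p∣n _) (·ᴾ-divisible ps v)) (+ᴹ-identityˡ 0ᴹ)

    ·ᴾ-vanishesMod : ∀ P → VanishesMod p P → ∀ v → v ·ᴾ P ≈ᴹ 0ᴹ
    ·ᴾ-vanishesMod P vanishes v = ≈ᴹ-trans (≈ᴹ-sym (·ᴾ-collect P v)) (·ᴾ-divisible vanishes v)

    module _ (engel : Is3Engel L) (x : Carrierᴹ) where

      vanishes-by-certificate : ∀ P cs → VanishesMod p (P ++ certificatePoly cs) → x ·ᴾ P ≈ᴹ 0ᴹ
      vanishes-by-certificate P cs vanishes = begin
        x ·ᴾ P                             ≈⟨ +ᴹ-identityʳ _ ⟨
        x ·ᴾ P +ᴹ 0ᴹ                       ≈⟨ +ᴹ-congˡ (certificatePoly-vanishes engel cs x) ⟨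
        x ·ᴾ P +ᴹ x ·ᴾ certificatePoly cs  ≈⟨ ·ᴾ-++ P _ x ⟨
        x ·ᴾ (P ++ certificatePoly cs)     ≈⟨ ·ᴾ-vanishesMod (P ++ certificatePoly cs) vanishes x ⟩
        0ᴹ                                 ∎

      equal-by-certificate : ∀ e₁ e₂ cs →
        True (vanishesMod? p ((linearPoly e₁ ++ negate (linearPoly e₂)) ++ certificatePoly cs)) →
        ⟦ e₁ ⟧ˡ x ≈ᴹ ⟦ e₂ ⟧ˡ x
      equal-by-certificate e₁ e₂ cs vanishes = x∙y⁻¹≈ε⇒x≈y _ _ (begin
        ⟦ e₁ ⟧ˡ x +ᴹ -ᴹ ⟦ e₂ ⟧ˡ x
          ≈⟨ +ᴹ-cong (linearPoly-correct e₁ x) (-ᴹ‿cong (linearPoly-correct e₂ x)) ⟩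
        x ·ᴾ linearPoly e₁ +ᴹ -ᴹ (x ·ᴾ linearPoly e₂)
          ≈⟨ +ᴹ-congˡ (·ᴾ-negate (linearPoly e₂) x) ⟨
        x ·ᴾ linearPoly e₁ +ᴹ x ·ᴾ negate (linearPoly e₂)
          ≈⟨ ·ᴾ-++ (linearPoly e₁) _ x ⟨
        x ·ᴾ (linearPoly e₁ ++ negate (linearPoly e₂))
          ≈⟨ vanishes-by-certificate (linearPoly e₁ ++ negate (linearPoly e₂)) cs (toWitness vanishes) ⟩
        0ᴹ ∎)

      opposite-by-certificate : ∀ e₁ e₂ cs →
        True (vanishesMod? p ((linearPoly e₁ ++ linearPoly e₂) ++ certificatePoly cs)) →
        ⟦ e₁ ⟧ˡ x ≈ᴹ -ᴹ ⟦ e₂ ⟧ˡ x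
      opposite-by-certificate e₁ e₂ cs vanishes = inverseˡ-unique _ _ (begin
        ⟦ e₁ ⟧ˡ x +ᴹ ⟦ e₂ ⟧ˡ x
          ≈⟨ +ᴹ-cong (linearPoly-correct e₁ x) (linearPoly-correct e₂ x) ⟩
        x ·ᴾ linearPoly e₁ +ᴹ x ·ᴾ linearPoly e₂
          ≈⟨ ·ᴾ-++ (linearPoly e₁) _ x ⟨
        x ·ᴾ (linearPoly e₁ ++ linearPoly e₂)
          ≈⟨ vanishes-by-certificate (linearPoly e₁ ++ linearPoly e₂) cs (toWitness vanishes) ⟩
        0ᴹ ∎)

mainTheorem3 :
    {r ℓ m ℓm : Level} (F : CommutativeRing r ℓ) → IsField F → HasChar5 F →
    (L : LieAlgebra F m ℓm) → Is3Engel L →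
    let open LieAlgebra L in
    ∀ x b c →
      (⟦ ⟦ ⟦ x , b ⟧ , c ⟧ , c ⟧ ≈ᴹ ⟦ ⟦ ⟦ x , c ⟧ , c ⟧ , b ⟧)
      × (⟦ ⟦ ⟦ ⟦ x , b ⟧ , b ⟧ , c ⟧ , c ⟧ ≈ᴹ ⟦ ⟦ ⟦ ⟦ x , c ⟧ , c ⟧ , b ⟧ , b ⟧)
      × (⟦ ⟦ x , ⟦ b , c ⟧ ⟧ , ⟦ b , c ⟧ ⟧ ≈ᴹ -ᴹ ⟦ ⟦ ⟦ ⟦ x , b ⟧ , b ⟧ , c ⟧ , c ⟧)
mainTheorem3 F _ char5 L engel x b c =
    equal-by-certificate engel x (• ◁ B ◁ C ◁ C) (• ◁ C ◁ C ◁ B)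
      ((3 , inner C • C B) ∷ (2 , inner B • C C) ∷ []) _
  , equal-by-certificate engel x (• ◁ B ◁ B ◁ C ◁ C) (• ◁ C ◁ C ◁ B ◁ B)
      ((4 , outer • (C ⊛ B) C B) ∷ (1 , inner C (B ▷ •) C B) ∷ (4 , inner B (C ▷ •) C B) ∷ []) _
  , opposite-by-certificate engel x (• ◁ B ⊛ C ◁ B ⊛ C) (• ◁ B ◁ B ◁ C ◁ C)
      ((2 , outer • (C ⊛ B) C B) ∷ (3 , inner C (C ▷ •) B B) ∷ (2 , outer (B ▷ •) C C B) ∷ []) _
  where
  generator : ℕ → LieAlgebra.Carrierᴹ L
  generator zero    = b
  generator (suc _) = c

  open AdjointAlgebra L 5 (×ᴹ-char5 L char5) generator

  B C : Term
  B = var 0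
  C = var 1
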